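{- Let $G=(V,E)$ be a graph on $n$ vertices and let $t$ be a positive integer. Consider the following procedure, which repeats until it returns: - pick a vertex $v\in V$ uniformly at random; - pick $j\in[t]$ uniformly at random; - if $\deg(v)\le t$ and $v$ has a $j$-th neighbor $u$ (i.e. $j\le \deg(v)$), return the edge $\{v,u\}$. Let $m'=|E(H(G,t))|$. The procedure outputs an edge of $H(G,t)$. There are absolute constants $c_1,c_2>0$ such that for each edge $e$ of $H(G,t)$, the probability that the procedure outputs $e$ lies in $[c_1/m', c_2/m']$. Moreover, if $m'\ge |E(G)|/2$, then the expected running time of the procedure is $O(t/\bar d(G))$.
   Context: For a threshold $t$, the heavy vertices are $H_t(G)=\{v:\deg(v)>t\}$ and the light vertices are $L_t(G)=V\setminus H_t(G)$. The graph $H(G,t)$ has vertex set $V$ and edge set $E(G)$ minus all edges whose two endpoints both lie in $H_t(G)$. The average degree is $\bar d(G)=2|E(G)|/n$. The procedure accesses $G$ via degree queries and neighbor queries; a neighbor query on $(v,j)$ returns the $j$-th neighbor of $v$. -}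

module Defs where

open import Data.Nat as ℕ using (ℕ; zero; suc)
open import Data.Nat.Properties using (_≤?_; _<?_)
open import Data.Fin using (Fin; toℕ) renaming (_≟_ to _≟ᶠ_)
open import Data.Bool using (Bool; true; false; if_then_else_; _∧_; _∨_; not)
open import Data.List using (List; []; _∷_; length; map; allFin)
open import Data.Nat.ListAction using (sum)
open import Data.List.Membership.Propositional using (_∈_; _∉_)
open import Data.List.Relation.Unary.Unique.Propositional using (Unique)
open import Data.Maybe using (Maybe; just; nothing)
open import Data.Integer using (+_)
open import Data.Rational using (ℚ; _/_; _+_; _*_; 0ℚ; 1ℚ)
open import Relation.Nullary.Decidable using (⌊_⌋)

-- A finite simple graph on vertex set Fin n, given by adjacency lists
-- (the neighbor query (v , j) returns the j-th entry of adj v).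
record Graph (n : ℕ) : Set where
  field
    adj    : Fin n → List (Fin n)
    noLoop : ∀ v → v ∉ adj v
    nodup  : ∀ v → Unique (adj v)
    symm   : ∀ u v → u ∈ adj v → v ∈ adj u
open Graph public

module _ {n : ℕ} (G : Graph n) where

  deg : Fin n → ℕ
  deg v = length (adj G v)

  adjB : Fin n → Fin n → Bool
  adjB a b = ⌊ b ∈? adj G a ⌋
    where open import Data.List.Membership.DecPropositional (_≟ᶠ_ {n}) using (_∈?_)

  heavyB : ℕ → Fin n → Bool
  heavyB t v = ⌊ t <? deg v ⌋

  hEdgeB : ℕ → Fin n → Fin n → Bool
  hEdgeB t a b = adjB a b ∧ not (heavyB t a ∧ heavyB t b)

#_ : ∀ {k : ℕ} → (Fin k → Bool) → ℕ
#_ {k} f = sum (map (λ i → if f i then 1 else 0) (allFin k))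

-- number of unordered pairs {a , b} (a ≠ b, counted once via toℕ a < toℕ b)
-- satisfying a symmetric Boolean predicate
#pairs : ∀ {n : ℕ} → (Fin n → Fin n → Bool) → ℕ
#pairs {n} P = sum (map (λ a → # (λ b → ⌊ toℕ a <? toℕ b ⌋ ∧ P a b)) (allFin n))

module _ {n : ℕ} (G : Graph n) where

  numEdges : ℕ
  numEdges = #pairs (adjB G)

  numHEdges : ℕ → ℕ
  numHEdges t = #pairs (hEdgeB G t)

nth : ∀ {A : Set} → List A → ℕ → Maybe A
nth []       _       = nothing
nth (x ∷ xs) zero    = just x
nth (x ∷ xs) (suc i) = nth xs i

-- c / N as a rational, with the convention c / 0 = 0
ratio : ℕ → ℕ → ℚ
ratio c zero    = 0ℚ
ratio c (suc N) = + c / suc N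

_^ℚ_ : ℚ → ℕ → ℚ
q ^ℚ zero  = 1ℚ
q ^ℚ suc k = q * (q ^ℚ k)

sumTo : ℕ → (ℕ → ℚ) → ℚ
sumTo zero    f = 0ℚ
sumTo (suc K) f = sumTo K f + f K

avgDeg : ∀ {n : ℕ} → Graph n → ℚ
avgDeg {n} G = ratio (2 ℕ.* numEdges G) n

module Procedure {n : ℕ} (G : Graph n) (t : ℕ) where

  -- One round, with random v ∈ V and j ∈ [t] (j ↔ 1 + toℕ j):
  -- returns just u (the edge {v , u}) iff deg v ≤ t and v has a j-th neighbour u.
  round : Fin n → Fin t → Maybe (Fin n)
  round v j = if ⌊ deg G v ≤? t ⌋ then nth (adj G v) (toℕ j) else nothing

  hitsB : Fin n → Fin n → Fin n → Fin t → Bool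
  hitsB a b v j with round v j
  ... | nothing = false
  ... | just u  = (⌊ v ≟ᶠ a ⌋ ∧ ⌊ u ≟ᶠ b ⌋) ∨ (⌊ v ≟ᶠ b ⌋ ∧ ⌊ u ≟ᶠ a ⌋)

  failB : Fin n → Fin t → Bool
  failB v j with round v j
  ... | nothing = true
  ... | just _  = false

  -- size of the sample space V × [t]
  N : ℕ
  N = n ℕ.* t

  pFail : ℚ
  pFail = ratio (sum (map (λ v → # (λ j → failB v j)) (allFin n))) N

  pHit : Fin n → Fin n → ℚ
  pHit a b = ratio (sum (map (λ v → # (λ j → hitsB a b v j)) (allFin n))) N

  -- Pr[the procedure outputs {a , b} within its first K rounds]
  --   = Σ_{k<K} pFail^k · pHit(a,b)   (rounds are independent)
  probOutputWithin : Fin n → Fin n → ℕ → ℚ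
  probOutputWithin a b K = sumTo K (λ k → (pFail ^ℚ k) * pHit a b)

  -- Σ_{k<K} Pr[T > k], where T is the number of rounds; E[T] = lim_K of this.
  expRoundsUpTo : ℕ → ℚ
  expRoundsUpTo K = sumTo K (λ k → pFail ^ℚ k)

{-# OPTIONS --safe #-}
module Submission where

-- A round draws a cell (v , j) uniformly from the N = n t cells of V × [t] and succeeds
-- exactly on the S = Σ_{v light} deg v cells with j < deg v.  Every edge of H(G,t) has a
-- light endpoint, so m' ≤ S ≤ 2 m', and each such edge {a , b} is returned by h ∈ {1, 2}
-- cells.  With failure probability p = 1 - S/N, the probability of returning {a , b}
-- within K rounds is (h/N)(1 - p^K)/(1 - p) = (h/S)(1 - p^K): at most 2/m', and at least
-- (1 - p^K)/(2 m') with p^K → 0.  The expected number of rounds is at most N/S, and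
-- d̄ = 2|E|/n ≤ 4 m'/n ≤ 4 S/n when m' ≥ |E|/2, so E[T] d̄ ≤ 4 t.

open import Defs
open import Data.Nat using (ℕ)

module IndicatorSums where

  open import Data.Nat using (zero; suc; _+_; _*_; _≤_; z≤n; s≤s)
  open import Data.Nat.Properties
  open import Data.Fin using (Fin; zero; suc)
  open import Data.Bool using (Bool; true; false; if_then_else_; _∧_; _∨_)
  open import Relation.Nullary using (Dec; yes; no)
  open import Relation.Nullary.Decidable using (⌊_⌋)
  open import Data.Empty using (⊥-elim)
  open import Data.List using (map; tabulate; allFin)
  import Data.Nat.ListAction as List
  open import Function using (_∘_; id)
  open import Relation.Binary.PropositionalEquality
  open import Algebra.Properties.Semiring.Sum +-*-semiring public
    using (sum-syntax; sum-cong-≗; sum-replicate-zero; ∑-distrib-+; ∑-comm; *-distribˡ-sum)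

  𝟙 : Bool → ℕ
  𝟙 b = if b then 1 else 0

  𝟙≤1 : ∀ b → 𝟙 b ≤ 1
  𝟙≤1 true  = s≤s z≤n
  𝟙≤1 false = z≤n

  ⌊⌋-true : ∀ {A : Set} (d : Dec A) → A → ⌊ d ⌋ ≡ true
  ⌊⌋-true (yes _) _ = refl
  ⌊⌋-true (no ¬a) a = ⊥-elim (¬a a)

  𝟙-∨-∧ : ∀ p q r s → 𝟙 ((p ∧ q) ∨ (r ∧ s)) ≤ 𝟙 p * 𝟙 q + 𝟙 r * 𝟙 s
  𝟙-∨-∧ true  true  _     _     = s≤s z≤n
  𝟙-∨-∧ true  false true  true  = s≤s z≤n
  𝟙-∨-∧ false _     true  true  = s≤s z≤n
  𝟙-∨-∧ true  false true  false = z≤n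
  𝟙-∨-∧ true  false false _     = z≤n
  𝟙-∨-∧ false _     true  false = z≤n
  𝟙-∨-∧ false _     false _     = z≤n

  sum-map-tabulate : ∀ {A : Set} k (g : A → ℕ) (h : Fin k → A) →
    List.sum (map g (tabulate h)) ≡ ∑[ i < k ] g (h i)
  sum-map-tabulate zero    g h = refl
  sum-map-tabulate (suc k) g h = cong (g (h zero) +_) (sum-map-tabulate k g (h ∘ suc))

  sum-map-allFin : ∀ k (f : Fin k → ℕ) → List.sum (map f (allFin k)) ≡ ∑[ i < k ] f i
  sum-map-allFin k f = sum-map-tabulate k f id

  ∑-mono-≤ : ∀ {k} {f g : Fin k → ℕ} → (∀ i → f i ≤ g i) → ∑[ i < k ] f i ≤ ∑[ i < k ] g i
  ∑-mono-≤ {zero}  f≤g = z≤n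
  ∑-mono-≤ {suc k} f≤g = +-mono-≤ (f≤g zero) (∑-mono-≤ (f≤g ∘ suc))

  f≤∑f : ∀ {k} (f : Fin k → ℕ) i → f i ≤ ∑[ j < k ] f j
  f≤∑f f zero    = m≤m+n _ _
  f≤∑f f (suc i) = ≤-trans (f≤∑f (f ∘ suc) i) (m≤n+m _ _)

  ∑-const : ∀ k c → ∑[ i < k ] c ≡ k * c
  ∑-const zero    c = refl
  ∑-const (suc k) c = cong (c +_) (∑-const k c)

  sum-#≡∑∑ : ∀ {n t} (P : Fin n → Fin t → Bool) →
    List.sum (map (λ v → # (P v)) (allFin n)) ≡ ∑[ v < n ] ∑[ j < t ] 𝟙 (P v j)
  sum-#≡∑∑ {n} {t} P = trans (sum-map-allFin n _) (sum-cong-≗ {n} (λ v → sum-map-allFin t _))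

module Counting where

  open IndicatorSums
  open import Data.Nat using (zero; suc; _+_; _*_; _≤_; _<_; z≤n; s≤s)
  open import Data.Nat.Properties
  open import Data.Fin using (Fin; zero; suc; toℕ) renaming (_≟_ to _≟ᶠ_)
  open import Data.Fin.Properties using (toℕ-injective)
  open import Data.Bool using (Bool; false; _∧_)
  open import Data.List using (List; []; _∷_; length)
  open import Data.List.Relation.Unary.Any using (here; there)
  open import Data.List.Relation.Unary.All using (lookup)
  open import Data.List.Relation.Unary.AllPairs using ([]; _∷_)
  open import Data.List.Membership.Propositional using (_∈_; _∉_)
  open import Data.List.Relation.Unary.Unique.Propositional using (Unique)
  open import Data.Maybe using (Maybe; just; is-just)
  open import Data.Maybe.Properties using (≡-dec)
  open import Data.Product using (Σ-syntax; _×_; _,_)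
  open import Relation.Nullary using (yes; no)
  open import Relation.Nullary.Decidable using (⌊_⌋; ⌊⌋-map′)
  open import Function using (_∘_)
  open import Data.Empty using (⊥-elim)
  open import Relation.Binary.PropositionalEquality
  open import Relation.Binary.Definitions using (DecidableEquality)

  ∑-select : ∀ {k} (a : Fin k) (g : Fin k → ℕ) → ∑[ v < k ] (𝟙 ⌊ v ≟ᶠ a ⌋ * g v) ≡ g a
  ∑-select {suc k} zero    g = trans (cong (g zero + 0 +_) (sum-replicate-zero k)) (trans (+-identityʳ _) (+-identityʳ _))
  ∑-select {suc k} (suc a) g =
    trans (sum-cong-≗ (λ v → cong (λ b → 𝟙 b * g (suc v)) (⌊⌋-map′ _ _ (v ≟ᶠ a)))) (∑-select a (g ∘ suc))

  count-≡ : ∀ {k} (a : Fin k) → ∑[ v < k ] 𝟙 ⌊ v ≟ᶠ a ⌋ ≡ 1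
  count-≡ {k} a = trans (sum-cong-≗ {k} (λ v → sym (*-identityʳ _))) (∑-select a (λ _ → 1))

  module _ {n : ℕ} where
    open import Data.List.Membership.DecPropositional (_≟ᶠ_ {n}) using (_∈?_)

    𝟙∈-∷ : ∀ {x : Fin n} {xs} → x ∉ xs → ∀ b → 𝟙 ⌊ b ∈? x ∷ xs ⌋ ≡ 𝟙 ⌊ b ≟ᶠ x ⌋ + 𝟙 ⌊ b ∈? xs ⌋
    𝟙∈-∷ {x} {xs} x∉xs b with b ∈? x ∷ xs | b ≟ᶠ x | b ∈? xs
    ... | _                | yes refl | yes b∈xs = ⊥-elim (x∉xs b∈xs)
    ... | yes _            | yes _    | no _     = refl
    ... | no b∉            | yes refl | no _     = ⊥-elim (b∉ (here refl))
    ... | yes (here b≡x)   | no b≢x   | _        = ⊥-elim (b≢x b≡x)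
    ... | yes (there _)    | no _     | yes _    = refl
    ... | yes (there b∈xs) | no _     | no b∉xs  = ⊥-elim (b∉xs b∈xs)
    ... | no b∉            | no _     | yes b∈xs = ⊥-elim (b∉ (there b∈xs))
    ... | no _             | no _     | no _     = refl

    count-∈ : ∀ (xs : List (Fin n)) → Unique xs → ∑[ b < n ] 𝟙 ⌊ b ∈? xs ⌋ ≡ length xs
    count-∈ []       _            = sum-replicate-zero n
    count-∈ (x ∷ xs) (x∉xs ∷ uxs) = begin
      ∑[ b < n ] 𝟙 ⌊ b ∈? x ∷ xs ⌋                         ≡⟨ sum-cong-≗ {n} (𝟙∈-∷ (λ x∈xs → lookup x∉xs x∈xs refl)) ⟩
      ∑[ b < n ] (𝟙 ⌊ b ≟ᶠ x ⌋ + 𝟙 ⌊ b ∈? xs ⌋)             ≡⟨ ∑-distrib-+ {n} _ _ ⟩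
      ∑[ b < n ] 𝟙 ⌊ b ≟ᶠ x ⌋ + ∑[ b < n ] 𝟙 ⌊ b ∈? xs ⌋   ≡⟨ cong₂ _+_ (count-≡ x) (count-∈ xs uxs) ⟩
      suc (length xs)                                      ∎
      where open ≡-Reasoning

  nth⇒∈ : ∀ {A : Set} (xs : List A) i {u} → nth xs i ≡ just u → u ∈ xs
  nth⇒∈ (x ∷ xs) zero    refl = here refl
  nth⇒∈ (x ∷ xs) (suc i) eq   = there (nth⇒∈ xs i eq)

  ∈⇒nth : ∀ {A : Set} {xs : List A} {u} → u ∈ xs → Σ[ i ∈ ℕ ] i < length xs × nth xs i ≡ just u
  ∈⇒nth (here refl) = 0 , s≤s z≤n , refl
  ∈⇒nth (there u∈xs) with ∈⇒nth u∈xs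
  ... | i , i<len , eq = suc i , s≤s i<len , eq

  count-nth-is-just : ∀ {A : Set} t (xs : List A) → length xs ≤ t →
    ∑[ j < t ] 𝟙 (is-just (nth xs (toℕ j))) ≡ length xs
  count-nth-is-just zero    []       _         = refl
  count-nth-is-just (suc t) []       _         = sum-replicate-zero t
  count-nth-is-just (suc t) (x ∷ xs) (s≤s len≤t) = cong suc (count-nth-is-just t xs len≤t)

  module _ {n : ℕ} where
    _≟ₘ_ : DecidableEquality (Maybe (Fin n))
    _≟ₘ_ = ≡-dec _≟ᶠ_

    count-nth-≡-∉ : ∀ t {b : Fin n} xs → b ∉ xs → ∑[ j < t ] 𝟙 ⌊ nth xs (toℕ j) ≟ₘ just b ⌋ ≡ 0
    count-nth-≡-∉ zero    xs       _    = refl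
    count-nth-≡-∉ (suc t) []       _    = sum-replicate-zero t
    count-nth-≡-∉ (suc t) {b} (x ∷ xs) b∉xs with x ≟ᶠ b
    ... | yes refl = ⊥-elim (b∉xs (here refl))
    ... | no _     = count-nth-≡-∉ t xs (b∉xs ∘ there)

    count-nth-≡≤1 : ∀ t (b : Fin n) xs → Unique xs → ∑[ j < t ] 𝟙 ⌊ nth xs (toℕ j) ≟ₘ just b ⌋ ≤ 1
    count-nth-≡≤1 zero    b xs       _            = z≤n
    count-nth-≡≤1 (suc t) b []       _            = ≤-trans (≤-reflexive (sum-replicate-zero t)) z≤n
    count-nth-≡≤1 (suc t) b (x ∷ xs) (x∉xs ∷ uxs) with x ≟ᶠ b
    ... | yes refl = ≤-reflexive (cong suc (count-nth-≡-∉ t xs (λ x∈xs → lookup x∉xs x∈xs refl)))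
    ... | no _     = count-nth-≡≤1 t b xs uxs

  module _ {n : ℕ} (P : Fin n → Fin n → Bool) where

    #pairs≡∑∑ : #pairs P ≡ ∑[ a < n ] ∑[ b < n ] 𝟙 (⌊ toℕ a <? toℕ b ⌋ ∧ P a b)
    #pairs≡∑∑ = sum-#≡∑∑ (λ a b → ⌊ toℕ a <? toℕ b ⌋ ∧ P a b)

    module _ (P-sym : ∀ a b → P a b ≡ P b a) (P-irrefl : ∀ a → P a a ≡ false) where

      𝟙-split-by-order : ∀ a b →
        𝟙 (P a b) ≡ 𝟙 (⌊ toℕ a <? toℕ b ⌋ ∧ P a b) + 𝟙 (⌊ toℕ b <? toℕ a ⌋ ∧ P b a)
      𝟙-split-by-order a b with toℕ a <? toℕ b | toℕ b <? toℕ a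
      ... | yes a<b | yes b<a = ⊥-elim (<-asym a<b b<a)
      ... | yes _   | no _    = sym (+-identityʳ _)
      ... | no _    | yes _   = cong 𝟙 (P-sym a b)
      ... | no a≮b  | no b≮a  with toℕ-injective (≤-antisym (≮⇒≥ b≮a) (≮⇒≥ a≮b))
      ...   | refl = cong 𝟙 (P-irrefl a)

      ∑∑-symmetric≡2#pairs : ∑[ a < n ] ∑[ b < n ] 𝟙 (P a b) ≡ 2 * #pairs P
      ∑∑-symmetric≡2#pairs = begin
        ∑[ a < n ] ∑[ b < n ] 𝟙 (P a b)
          ≡⟨ sum-cong-≗ {n} (λ a → trans (sum-cong-≗ {n} (𝟙-split-by-order a)) (∑-distrib-+ {n} _ _)) ⟩
        ∑[ a < n ] (∑[ b < n ] ordered a b + ∑[ b < n ] ordered b a)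
          ≡⟨ ∑-distrib-+ {n} _ _ ⟩
        ∑[ a < n ] ∑[ b < n ] ordered a b + ∑[ a < n ] ∑[ b < n ] ordered b a
          ≡⟨ cong₂ _+_ (sym #pairs≡∑∑) (trans (∑-comm {n} {n} (λ a b → ordered b a)) (sym #pairs≡∑∑)) ⟩
        #pairs P + #pairs P
          ≡⟨ cong (#pairs P +_) (+-identityʳ _) ⟨
        2 * #pairs P ∎
        where
        open ≡-Reasoning
        ordered : Fin n → Fin n → ℕ
        ordered a b = 𝟙 (⌊ toℕ a <? toℕ b ⌋ ∧ P a b)

module LightEdges {n : ℕ} (G : Graph n) (t : ℕ) where

  open IndicatorSums
  open Counting
  open import Data.Nat using (_+_; _*_; _≤_; z≤n; s≤s)
  open import Data.Nat.Properties
  open import Data.Fin using (Fin) renaming (_≟_ to _≟ᶠ_)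
  open import Data.Bool using (Bool; true; false; _∧_; _∨_; not)
  open import Data.List.Membership.Propositional using (_∈_)
  open import Data.Product using (_×_; _,_)
  open import Data.Sum using (_⊎_; inj₁; inj₂)
  open import Data.Empty using (⊥-elim)
  open import Relation.Nullary using (yes; no)
  open import Relation.Nullary.Decidable using (⌊_⌋)
  open import Relation.Binary.PropositionalEquality

  open import Data.List.Membership.DecPropositional (_≟ᶠ_ {n}) using (_∈?_)

  light : Fin n → Bool
  light v = ⌊ deg G v ≤? t ⌋

  light⇒deg≤t : ∀ v → light v ≡ true → deg G v ≤ t
  light⇒deg≤t v with deg G v ≤? t
  ... | yes d≤t = λ _ → d≤t
  ... | no _    = λ ()

  heavy≡not-light : ∀ v → heavyB G t v ≡ not (light v)
  heavy≡not-light v with t <? deg G v | deg G v ≤? t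
  ... | yes t<d | yes d≤t = ⊥-elim (<⇒≱ t<d d≤t)
  ... | yes _   | no _    = refl
  ... | no _    | yes _   = refl
  ... | no t≮d  | no d≰t  = ⊥-elim (t≮d (≰⇒> d≰t))

  adjB⇒∈ : ∀ a b → adjB G a b ≡ true → b ∈ adj G a
  adjB⇒∈ a b with b ∈? adj G a
  ... | yes b∈adj = λ _ → b∈adj
  ... | no _      = λ ()

  ∈⇒adjB : ∀ a b → b ∈ adj G a → adjB G a b ≡ true
  ∈⇒adjB a b b∈adj with b ∈? adj G a
  ... | yes _      = refl
  ... | no b∉adj   = ⊥-elim (b∉adj b∈adj)

  adjB-sym : ∀ a b → adjB G a b ≡ adjB G b a
  adjB-sym a b with b ∈? adj G a | a ∈? adj G b
  ... | yes _     | yes _     = refl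
  ... | yes b∈adj | no a∉adj  = ⊥-elim (a∉adj (symm G b a b∈adj))
  ... | no b∉adj  | yes a∈adj = ⊥-elim (b∉adj (symm G a b a∈adj))
  ... | no _      | no _      = refl

  adjB-irrefl : ∀ a → adjB G a a ≡ false
  adjB-irrefl a with a ∈? adj G a
  ... | yes a∈adj = ⊥-elim (noLoop G a a∈adj)
  ... | no _      = refl

  hEdgeB≡ : ∀ a b → hEdgeB G t a b ≡ adjB G a b ∧ (light a ∨ light b)
  hEdgeB≡ a b rewrite heavy≡not-light a | heavy≡not-light b with light a | light b
  ... | true  | _     = refl
  ... | false | true  = refl
  ... | false | false = refl

  hEdgeB-sym : ∀ a b → hEdgeB G t a b ≡ hEdgeB G t b a
  hEdgeB-sym a b rewrite hEdgeB≡ a b | hEdgeB≡ b a | adjB-sym a b with light a | light b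
  ... | true  | true  = refl
  ... | true  | false = refl
  ... | false | true  = refl
  ... | false | false = refl

  hEdgeB-irrefl : ∀ a → hEdgeB G t a a ≡ false
  hEdgeB-irrefl a rewrite adjB-irrefl a = refl

  lightEdgeB : Fin n → Fin n → Bool
  lightEdgeB a b = light a ∧ adjB G a b

  lightEdge≤hEdge : ∀ a b → 𝟙 (lightEdgeB a b) ≤ 𝟙 (hEdgeB G t a b)
  lightEdge≤hEdge a b rewrite hEdgeB≡ a b with light a | adjB G a b
  ... | true  | true  = ≤-refl
  ... | true  | false = z≤n
  ... | false | _     = z≤n

  hEdge≤lightEdges : ∀ a b → 𝟙 (hEdgeB G t a b) ≤ 𝟙 (lightEdgeB a b) + 𝟙 (lightEdgeB b a)
  hEdge≤lightEdges a b rewrite hEdgeB≡ a b | adjB-sym b a with adjB G a b | light a | light b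
  ... | false | _     | _     = z≤n
  ... | true  | true  | _     = s≤s z≤n
  ... | true  | false | true  = s≤s z≤n
  ... | true  | false | false = z≤n

  ∑-lightEdgeB : ∀ a → ∑[ b < n ] 𝟙 (lightEdgeB a b) ≡ 𝟙 (light a) * deg G a
  ∑-lightEdgeB a with light a
  ... | true  = trans (count-∈ (adj G a) (nodup G a)) (sym (+-identityʳ _))
  ... | false = sum-replicate-zero n

  lightDegreeSum : ℕ
  lightDegreeSum = ∑[ v < n ] (𝟙 (light v) * deg G v)

  lightDegreeSum≡∑∑lightEdgeB : lightDegreeSum ≡ ∑[ a < n ] ∑[ b < n ] 𝟙 (lightEdgeB a b)
  lightDegreeSum≡∑∑lightEdgeB = sym (sum-cong-≗ {n} ∑-lightEdgeB)

  lightDegreeSum≤2*numHEdges : lightDegreeSum ≤ 2 * numHEdges G t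
  lightDegreeSum≤2*numHEdges = begin
    lightDegreeSum                                   ≡⟨ lightDegreeSum≡∑∑lightEdgeB ⟩
    ∑[ a < n ] ∑[ b < n ] 𝟙 (lightEdgeB a b)        ≤⟨ ∑-mono-≤ (λ a → ∑-mono-≤ (lightEdge≤hEdge a)) ⟩
    ∑[ a < n ] ∑[ b < n ] 𝟙 (hEdgeB G t a b)        ≡⟨ ∑∑-symmetric≡2#pairs (hEdgeB G t) hEdgeB-sym hEdgeB-irrefl ⟩
    2 * numHEdges G t                                ∎
    where open ≤-Reasoning

  2*numHEdges≤2*lightDegreeSum : 2 * numHEdges G t ≤ 2 * lightDegreeSum
  2*numHEdges≤2*lightDegreeSum = begin
    2 * numHEdges G t
      ≡⟨ ∑∑-symmetric≡2#pairs (hEdgeB G t) hEdgeB-sym hEdgeB-irrefl ⟨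
    ∑[ a < n ] ∑[ b < n ] 𝟙 (hEdgeB G t a b)
      ≤⟨ ∑-mono-≤ (λ a → ∑-mono-≤ (hEdge≤lightEdges a)) ⟩
    ∑[ a < n ] ∑[ b < n ] (𝟙 (lightEdgeB a b) + 𝟙 (lightEdgeB b a))
      ≡⟨ sum-cong-≗ {n} (λ a → ∑-distrib-+ {n} _ _) ⟩
    ∑[ a < n ] (∑[ b < n ] 𝟙 (lightEdgeB a b) + ∑[ b < n ] 𝟙 (lightEdgeB b a))
      ≡⟨ ∑-distrib-+ {n} _ _ ⟩
    ∑[ a < n ] ∑[ b < n ] 𝟙 (lightEdgeB a b) + ∑[ a < n ] ∑[ b < n ] 𝟙 (lightEdgeB b a)
      ≡⟨ cong (∑[ a < n ] ∑[ b < n ] 𝟙 (lightEdgeB a b) +_) (∑-comm {n} {n} (λ a b → 𝟙 (lightEdgeB b a))) ⟩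
    ∑[ a < n ] ∑[ b < n ] 𝟙 (lightEdgeB a b) + ∑[ b < n ] ∑[ a < n ] 𝟙 (lightEdgeB b a)
      ≡⟨ cong₂ _+_ lightDegreeSum≡∑∑lightEdgeB lightDegreeSum≡∑∑lightEdgeB ⟨
    lightDegreeSum + lightDegreeSum
      ≡⟨ cong (lightDegreeSum +_) (+-identityʳ _) ⟨
    2 * lightDegreeSum ∎
    where open ≤-Reasoning

  numHEdges≤lightDegreeSum : numHEdges G t ≤ lightDegreeSum
  numHEdges≤lightDegreeSum = *-cancelˡ-≤ 2 2*numHEdges≤2*lightDegreeSum

  hEdgeB⇒ : ∀ a b → hEdgeB G t a b ≡ true → b ∈ adj G a × (light a ≡ true ⊎ light b ≡ true)
  hEdgeB⇒ a b eq rewrite hEdgeB≡ a b with adjB G a b in adj-ab | light a | light b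
  ... | true | true  | _    = adjB⇒∈ a b adj-ab , inj₁ refl
  ... | true | false | true = adjB⇒∈ a b adj-ab , inj₂ refl

module Rounds {n : ℕ} (G : Graph n) (t : ℕ) where

  open IndicatorSums
  open Counting
  open LightEdges G t
  open Procedure G t
  open import Data.Nat using (_+_; _*_; _≤_; z≤n)
  open import Data.Nat.Properties
  open import Data.Fin using (Fin; toℕ; fromℕ<) renaming (_≟_ to _≟ᶠ_)
  open import Data.Fin.Properties using (toℕ-fromℕ<)
  open import Data.Bool using (true; _∧_)
  open import Data.Bool.Properties using (∨-comm)
  open import Data.List.Membership.Propositional using (_∈_)
  open import Data.Maybe using (just; nothing; is-just)
  open import Data.Maybe.Properties using (just-injective)
  open import Data.Product using (Σ-syntax; _×_; _,_)
  open import Data.Sum using (inj₁; inj₂)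
  open import Relation.Nullary using (yes; no)
  open import Relation.Nullary.Decidable using (⌊_⌋; ⌊⌋-map′)
  open import Relation.Binary.PropositionalEquality

  round-just : ∀ v j {u} → round v j ≡ just u → light v ≡ true × u ∈ adj G v
  round-just v j with deg G v ≤? t
  ... | yes _ = λ eq → refl , nth⇒∈ (adj G v) (toℕ j) eq
  ... | no _  = λ ()

  round-sound : ∀ v j u → round v j ≡ just u → hEdgeB G t v u ≡ true
  round-sound v j u eq with round-just v j eq
  ... | light-v , u∈adj rewrite hEdgeB≡ v u | ∈⇒adjB v u u∈adj | light-v = refl

  round-of-light : ∀ v j → light v ≡ true → round v j ≡ nth (adj G v) (toℕ j)
  round-of-light v j with deg G v ≤? t
  ... | yes _ = λ _ → refl
  ... | no _  = λ ()

  ∈⇒round : ∀ v u → light v ≡ true → u ∈ adj G v → Σ[ j ∈ Fin t ] round v j ≡ just u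
  ∈⇒round v u light-v u∈adj with ∈⇒nth u∈adj
  ... | i , i<deg , eq = j , trans (round-of-light v j light-v) (trans (cong (nth (adj G v)) (toℕ-fromℕ< _)) eq)
    where
    j : Fin t
    j = fromℕ< (<-≤-trans i<deg (light⇒deg≤t v light-v))

  ∑-round-is-just : ∀ v → ∑[ j < t ] 𝟙 (is-just (round v j)) ≡ 𝟙 (light v) * deg G v
  ∑-round-is-just v with deg G v ≤? t
  ... | yes d≤t = trans (count-nth-is-just t (adj G v) d≤t) (sym (+-identityʳ _))
  ... | no _    = sum-replicate-zero t

  𝟙-failB+𝟙-is-just≡1 : ∀ v j → 𝟙 (failB v j) + 𝟙 (is-just (round v j)) ≡ 1
  𝟙-failB+𝟙-is-just≡1 v j with round v j
  ... | nothing = refl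
  ... | just _  = refl

  failures : ℕ
  failures = ∑[ v < n ] ∑[ j < t ] 𝟙 (failB v j)

  failures+lightDegreeSum≡nt : failures + lightDegreeSum ≡ n * t
  failures+lightDegreeSum≡nt = begin
    failures + lightDegreeSum
      ≡⟨ cong (failures +_) (sum-cong-≗ {n} ∑-round-is-just) ⟨
    failures + ∑[ v < n ] ∑[ j < t ] 𝟙 (is-just (round v j))
      ≡⟨ ∑-distrib-+ {n} _ _ ⟨
    ∑[ v < n ] (∑[ j < t ] 𝟙 (failB v j) + ∑[ j < t ] 𝟙 (is-just (round v j)))
      ≡⟨ sum-cong-≗ {n} (λ v → ∑-distrib-+ {t} _ _) ⟨
    ∑[ v < n ] ∑[ j < t ] (𝟙 (failB v j) + 𝟙 (is-just (round v j)))
      ≡⟨ sum-cong-≗ {n} (λ v → trans (sum-cong-≗ {t} (𝟙-failB+𝟙-is-just≡1 v)) (trans (∑-const t 1) (*-identityʳ t))) ⟩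
    ∑[ v < n ] t
      ≡⟨ ∑-const n t ⟩
    n * t ∎
    where open ≡-Reasoning

  returns : Fin n → Fin n → ℕ
  returns v u = ∑[ j < t ] 𝟙 ⌊ round v j ≟ₘ just u ⌋

  returns≤1 : ∀ v u → returns v u ≤ 1
  returns≤1 v u with deg G v ≤? t
  ... | yes _ = count-nth-≡≤1 t u (adj G v) (nodup G v)
  ... | no _  = ≤-trans (≤-reflexive (sum-replicate-zero t)) z≤n

  hits : Fin n → Fin n → ℕ
  hits a b = ∑[ v < n ] ∑[ j < t ] 𝟙 (hitsB a b v j)

  𝟙-hitsB≤ : ∀ a b v j → 𝟙 (hitsB a b v j) ≤
    𝟙 ⌊ v ≟ᶠ a ⌋ * 𝟙 ⌊ round v j ≟ₘ just b ⌋ + 𝟙 ⌊ v ≟ᶠ b ⌋ * 𝟙 ⌊ round v j ≟ₘ just a ⌋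
  𝟙-hitsB≤ a b v j with round v j
  ... | nothing = z≤n
  ... | just u rewrite ⌊⌋-map′ (cong just) just-injective (u ≟ᶠ b)
                     | ⌊⌋-map′ (cong just) just-injective (u ≟ᶠ a) = 𝟙-∨-∧ ⌊ v ≟ᶠ a ⌋ ⌊ u ≟ᶠ b ⌋ ⌊ v ≟ᶠ b ⌋ ⌊ u ≟ᶠ a ⌋

  hits≤2 : ∀ a b → hits a b ≤ 2
  hits≤2 a b = begin
    hits a b
      ≤⟨ ∑-mono-≤ (λ v → ∑-mono-≤ (𝟙-hitsB≤ a b v)) ⟩
    ∑[ v < n ] ∑[ j < t ] (𝟙 ⌊ v ≟ᶠ a ⌋ * returnsAt v j b + 𝟙 ⌊ v ≟ᶠ b ⌋ * returnsAt v j a)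
      ≡⟨ sum-cong-≗ {n} (λ v → ∑-distrib-+ {t} _ _) ⟩
    ∑[ v < n ] (∑[ j < t ] (𝟙 ⌊ v ≟ᶠ a ⌋ * returnsAt v j b) + ∑[ j < t ] (𝟙 ⌊ v ≟ᶠ b ⌋ * returnsAt v j a))
      ≡⟨ sum-cong-≗ {n} (λ v → cong₂ _+_ (*-distribˡ-sum (𝟙 ⌊ v ≟ᶠ a ⌋) (λ j → returnsAt v j b)) (*-distribˡ-sum (𝟙 ⌊ v ≟ᶠ b ⌋) (λ j → returnsAt v j a))) ⟨
    ∑[ v < n ] (𝟙 ⌊ v ≟ᶠ a ⌋ * returns v b + 𝟙 ⌊ v ≟ᶠ b ⌋ * returns v a)
      ≡⟨ ∑-distrib-+ {n} _ _ ⟩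
    ∑[ v < n ] (𝟙 ⌊ v ≟ᶠ a ⌋ * returns v b) + ∑[ v < n ] (𝟙 ⌊ v ≟ᶠ b ⌋ * returns v a)
      ≡⟨ cong₂ _+_ (∑-select a (λ v → returns v b)) (∑-select b (λ v → returns v a)) ⟩
    returns a b + returns b a
      ≤⟨ +-mono-≤ (returns≤1 a b) (returns≤1 b a) ⟩
    2 ∎
    where
    open ≤-Reasoning
    returnsAt : Fin n → Fin t → Fin n → ℕ
    returnsAt v j u = 𝟙 ⌊ round v j ≟ₘ just u ⌋

  hitsB-sym : ∀ a b v j → hitsB a b v j ≡ hitsB b a v j
  hitsB-sym a b v j with round v j
  ... | nothing = refl
  ... | just u  = ∨-comm (⌊ v ≟ᶠ a ⌋ ∧ ⌊ u ≟ᶠ b ⌋) (⌊ v ≟ᶠ b ⌋ ∧ ⌊ u ≟ᶠ a ⌋)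

  hitsB-self : ∀ a b j → round a j ≡ just b → hitsB a b a j ≡ true
  hitsB-self a b j eq with round a j | eq
  ... | just .b | refl rewrite ⌊⌋-true (a ≟ᶠ a) refl | ⌊⌋-true (b ≟ᶠ b) refl = refl

  hitsB⇒1≤hits : ∀ a b v j → hitsB a b v j ≡ true → 1 ≤ hits a b
  hitsB⇒1≤hits a b v j hit = begin
    1                                      ≡⟨ cong 𝟙 hit ⟨
    𝟙 (hitsB a b v j)                      ≤⟨ f≤∑f (λ j → 𝟙 (hitsB a b v j)) j ⟩
    ∑[ j < t ] 𝟙 (hitsB a b v j)           ≤⟨ f≤∑f (λ v → ∑[ j < t ] 𝟙 (hitsB a b v j)) v ⟩
    hits a b                               ∎
    where open ≤-Reasoning

  1≤hits : ∀ a b → hEdgeB G t a b ≡ true → 1 ≤ hits a b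
  1≤hits a b e with hEdgeB⇒ a b e
  ... | b∈adj , inj₁ light-a with ∈⇒round a b light-a b∈adj
  ...   | j , eq = hitsB⇒1≤hits a b a j (hitsB-self a b j eq)
  1≤hits a b e | b∈adj , inj₂ light-b with ∈⇒round b a light-b (symm G b a b∈adj)
  ...   | j , eq = hitsB⇒1≤hits a b b j (trans (hitsB-sym a b b j) (hitsB-self b a j eq))

  𝟙-hitsB≤𝟙-is-just : ∀ a b v j → 𝟙 (hitsB a b v j) ≤ 𝟙 (is-just (round v j))
  𝟙-hitsB≤𝟙-is-just a b v j with round v j
  ... | nothing = z≤n
  ... | just _  = 𝟙≤1 _

  hits≤lightDegreeSum : ∀ a b → hits a b ≤ lightDegreeSum
  hits≤lightDegreeSum a b = begin
    hits a b                                          ≤⟨ ∑-mono-≤ (λ v → ∑-mono-≤ (𝟙-hitsB≤𝟙-is-just a b v)) ⟩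
    ∑[ v < n ] ∑[ j < t ] 𝟙 (is-just (round v j))     ≡⟨ sum-cong-≗ {n} ∑-round-is-just ⟩
    lightDegreeSum                                    ∎
    where open ≤-Reasoning

module NatCast where

  open import Data.Nat as ℕ using (suc)
  import Data.Nat.Properties as ℕ
  open import Data.Integer as ℤ using (+_; +[1+_]; -[1+_]; +≤+)
  import Data.Integer.Properties as ℤ
  open import Data.Rational
  open import Data.Rational.Properties
  open import Data.Rational.Unnormalised as ℚᵘ using (mkℚᵘ; *≡*; *≤*)
  import Data.Rational.Unnormalised.Properties as ℚᵘ
  open import Data.Nat.Coprimality as Coprime using (1-coprimeTo)
  open import Data.Product using (Σ-syntax; _,_)
  open import Data.Empty using (⊥-elim)
  open import Relation.Binary.PropositionalEquality

  fromℕ : ℕ → ℚ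
  fromℕ a = + a / 1

  toℚᵘ-fromℕ : ∀ a → toℚᵘ (fromℕ a) ≡ mkℚᵘ (+ a) 0
  toℚᵘ-fromℕ a = cong toℚᵘ (normalize-coprime (Coprime.sym (1-coprimeTo a)))

  fromℕ-+ : ∀ a b → fromℕ (a ℕ.+ b) ≡ fromℕ a + fromℕ b
  fromℕ-+ a b = toℚᵘ-injective (begin
    toℚᵘ (fromℕ (a ℕ.+ b))                ≡⟨ toℚᵘ-fromℕ (a ℕ.+ b) ⟩
    mkℚᵘ (+ (a ℕ.+ b)) 0                  ≈⟨ *≡* eq ⟩
    mkℚᵘ (+ a) 0 ℚᵘ.+ mkℚᵘ (+ b) 0        ≡⟨ cong₂ ℚᵘ._+_ (toℚᵘ-fromℕ a) (toℚᵘ-fromℕ b) ⟨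
    toℚᵘ (fromℕ a) ℚᵘ.+ toℚᵘ (fromℕ b)    ≈⟨ toℚᵘ-homo-+ (fromℕ a) (fromℕ b) ⟨
    toℚᵘ (fromℕ a + fromℕ b)              ∎)
    where
    open ℚᵘ.≃-Reasoning
    eq : + (a ℕ.+ b) ℤ.* + 1 ≡ (+ a ℤ.* + 1 ℤ.+ + b ℤ.* + 1) ℤ.* + 1
    eq rewrite ℤ.*-identityʳ (+ (a ℕ.+ b)) | ℤ.*-identityʳ (+ a) | ℤ.*-identityʳ (+ b)
             | ℤ.*-identityʳ (+ a ℤ.+ + b) = ℤ.pos-+ a b

  fromℕ-* : ∀ a b → fromℕ (a ℕ.* b) ≡ fromℕ a * fromℕ b
  fromℕ-* a b = toℚᵘ-injective (begin
    toℚᵘ (fromℕ (a ℕ.* b))                ≡⟨ toℚᵘ-fromℕ (a ℕ.* b) ⟩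
    mkℚᵘ (+ (a ℕ.* b)) 0                  ≈⟨ *≡* (cong (ℤ._* + 1) (ℤ.pos-* a b)) ⟩
    mkℚᵘ (+ a) 0 ℚᵘ.* mkℚᵘ (+ b) 0        ≡⟨ cong₂ ℚᵘ._*_ (toℚᵘ-fromℕ a) (toℚᵘ-fromℕ b) ⟨
    toℚᵘ (fromℕ a) ℚᵘ.* toℚᵘ (fromℕ b)    ≈⟨ toℚᵘ-homo-* (fromℕ a) (fromℕ b) ⟨
    toℚᵘ (fromℕ a * fromℕ b)              ∎)
    where open ℚᵘ.≃-Reasoning

  [a/n]*n≡a : ∀ a n → (+ a / suc n) * fromℕ (suc n) ≡ fromℕ a
  [a/n]*n≡a a n = toℚᵘ-injective (begin
    toℚᵘ ((+ a / suc n) * fromℕ (suc n))              ≈⟨ toℚᵘ-homo-* (+ a / suc n) (fromℕ (suc n)) ⟩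
    toℚᵘ (+ a / suc n) ℚᵘ.* toℚᵘ (fromℕ (suc n))      ≈⟨ ℚᵘ.*-congʳ (toℚᵘ-fromℚᵘ (mkℚᵘ (+ a) n)) ⟩
    mkℚᵘ (+ a) n ℚᵘ.* toℚᵘ (fromℕ (suc n))            ≡⟨ cong (mkℚᵘ (+ a) n ℚᵘ.*_) (toℚᵘ-fromℕ (suc n)) ⟩
    mkℚᵘ (+ a) n ℚᵘ.* mkℚᵘ (+ suc n) 0                ≈⟨ *≡* eq ⟩
    mkℚᵘ (+ a) 0                                      ≡⟨ toℚᵘ-fromℕ a ⟨
    toℚᵘ (fromℕ a)                                    ∎)
    where
    open ℚᵘ.≃-Reasoning
    eq : (+ a ℤ.* + suc n) ℤ.* + 1 ≡ + a ℤ.* + suc (n ℕ.* 1)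
    eq rewrite ℕ.*-identityʳ n = ℤ.*-identityʳ _

  fromℕ-mono-≤ : ∀ {a b} → a ℕ.≤ b → fromℕ a ≤ fromℕ b
  fromℕ-mono-≤ {a} {b} a≤b = toℚᵘ-cancel-≤ (subst₂ ℚᵘ._≤_ (sym (toℚᵘ-fromℕ a)) (sym (toℚᵘ-fromℕ b)) (*≤* le))
    where
    le : + a ℤ.* + 1 ℤ.≤ + b ℤ.* + 1
    le rewrite ℤ.*-identityʳ (+ a) | ℤ.*-identityʳ (+ b) = +≤+ a≤b

  0≤fromℕ : ∀ a → 0ℚ ≤ fromℕ a
  0≤fromℕ a = fromℕ-mono-≤ {0} {a} ℕ.z≤n

  fromℕ-suc-positive : ∀ a → Positive (fromℕ (suc a))
  fromℕ-suc-positive a = normalize-pos (suc a) 1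

  0≤a/n : ∀ a n → 0ℚ ≤ + a / suc n
  0≤a/n a n = nonNegative⁻¹ _ {{normalize-nonNeg a (suc n)}}

  *-cancelʳ-≤-fromℕ-suc : ∀ n {p q} → p * fromℕ (suc n) ≤ q * fromℕ (suc n) → p ≤ q
  *-cancelʳ-≤-fromℕ-suc n = *-cancelʳ-≤-pos (fromℕ (suc n)) {{fromℕ-suc-positive n}}

  archimedean : ∀ ε → 0ℚ < ε → Σ[ d ∈ ℕ ] 1ℚ ≤ ε * fromℕ (suc d)
  archimedean ε@(mkℚ +[1+ k ] d coprime) _ = d , (begin
    1ℚ                                   ≤⟨ fromℕ-mono-≤ {1} {suc k} (ℕ.s≤s ℕ.z≤n) ⟩
    fromℕ (suc k)                        ≡⟨ [a/n]*n≡a (suc k) d ⟨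
    (+ suc k / suc d) * fromℕ (suc d)    ≡⟨ cong (_* fromℕ (suc d)) (normalize-coprime coprime) ⟩
    ε * fromℕ (suc d)                    ∎)
    where open ≤-Reasoning
  archimedean (mkℚ (+ 0) d coprime) 0<ε = ⊥-elim (<-irrefl (sym (↥p≡0⇒p≡0 _ refl)) 0<ε)
  archimedean (mkℚ -[1+ k ] d coprime) 0<ε = ⊥-elim (<-asym 0<ε (negative⁻¹ _))

module Geometric where

  open NatCast
  open import Data.Nat as ℕ using (zero; suc)
  open import Data.Nat.Properties using (m≤m+n)
  open import Data.Integer using (+_)
  open import Data.Rational
  open import Data.Rational.Properties
  open import Data.Rational.Solver using (module +-*-Solver)
  open import Data.Product using (Σ-syntax; _,_; map₂)
  open import Relation.Binary.PropositionalEquality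
  open +-*-Solver

  geom : ℚ → ℕ → ℚ
  geom p K = sumTo K (λ k → p ^ℚ k)

  sumTo-*ʳ : ∀ K (f : ℕ → ℚ) c → sumTo K (λ k → f k * c) ≡ sumTo K f * c
  sumTo-*ʳ zero    f c = sym (*-zeroˡ c)
  sumTo-*ʳ (suc K) f c = trans (cong (_+ f K * c) (sumTo-*ʳ K f c)) (sym (*-distribʳ-+ c (sumTo K f) (f K)))

  [1-p]*geom≡1-p^K : ∀ p K → (1ℚ - p) * geom p K ≡ 1ℚ - p ^ℚ K
  [1-p]*geom≡1-p^K p zero    = solve 1 (λ p → (con 1ℚ :- p) :* con 0ℚ := con 1ℚ :- con 1ℚ) refl p
  [1-p]*geom≡1-p^K p (suc K) = begin
    (1ℚ - p) * (geom p K + p ^ℚ K)           ≡⟨ solve 3 (λ p g x → (con 1ℚ :- p) :* (g :+ x) := (con 1ℚ :- p) :* g :+ (x :- p :* x)) refl p (geom p K) (p ^ℚ K) ⟩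
    (1ℚ - p) * geom p K + (p ^ℚ K - p * p ^ℚ K) ≡⟨ cong (_+ (p ^ℚ K - p * p ^ℚ K)) ([1-p]*geom≡1-p^K p K) ⟩
    (1ℚ - p ^ℚ K) + (p ^ℚ K - p * p ^ℚ K)     ≡⟨ solve 2 (λ p x → (con 1ℚ :- x) :+ (x :- p :* x) := con 1ℚ :- p :* x) refl p (p ^ℚ K) ⟩
    1ℚ - p * p ^ℚ K                           ∎
    where open ≡-Reasoning

  0≤p*q : ∀ {p q} → 0ℚ ≤ p → 0ℚ ≤ q → 0ℚ ≤ p * q
  0≤p*q {p} 0≤p 0≤q = ≤-trans (≤-reflexive (sym (*-zeroʳ p))) (*-monoˡ-≤-nonNeg p {{nonNegative 0≤p}} 0≤q)

  p≤1⇒p*q≤q : ∀ {p q} → 0ℚ ≤ q → p ≤ 1ℚ → p * q ≤ q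
  p≤1⇒p*q≤q {p} {q} 0≤q p≤1 = ≤-trans (*-monoʳ-≤-nonNeg q {{nonNegative 0≤q}} p≤1) (≤-reflexive (*-identityˡ q))

  1≤q⇒p≤p*q : ∀ {p q} → 0ℚ ≤ p → 1ℚ ≤ q → p ≤ p * q
  1≤q⇒p≤p*q {p} 0≤p 1≤q = ≤-trans (≤-reflexive (sym (*-identityʳ p))) (*-monoˡ-≤-nonNeg p {{nonNegative 0≤p}} 1≤q)

  1-p≤1 : ∀ {p} → 0ℚ ≤ p → 1ℚ - p ≤ 1ℚ
  1-p≤1 0≤p = +-monoʳ-≤ 1ℚ (neg-antimono-≤ 0≤p)

  0≤p^K : ∀ {p} K → 0ℚ ≤ p → 0ℚ ≤ p ^ℚ K
  0≤p^K zero    _   = ≤-trans (0≤fromℕ 0) (fromℕ-mono-≤ {0} {1} ℕ.z≤n)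
  0≤p^K (suc K) 0≤p = 0≤p*q 0≤p (0≤p^K K 0≤p)

  0≤geom : ∀ {p} K → 0ℚ ≤ p → 0ℚ ≤ geom p K
  0≤geom zero    _   = ≤-refl
  0≤geom (suc K) 0≤p = +-mono-≤ (0≤geom K 0≤p) (0≤p^K K 0≤p)

  K*p^K≤geom : ∀ {p} K → 0ℚ ≤ p → p ≤ 1ℚ → fromℕ K * p ^ℚ K ≤ geom p K
  K*p^K≤geom zero    _   _   = ≤-refl
  K*p^K≤geom {p} (suc K) 0≤p p≤1 = begin
    fromℕ (suc K) * (p * x)     ≡⟨ cong (_* (p * x)) (fromℕ-+ 1 K) ⟩
    (1ℚ + fromℕ K) * (p * x)    ≡⟨ solve 3 (λ k p x → (con 1ℚ :+ k) :* (p :* x) := k :* (p :* x) :+ p :* x) refl (fromℕ K) p x ⟩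
    fromℕ K * (p * x) + p * x   ≤⟨ +-mono-≤ (*-monoˡ-≤-nonNeg (fromℕ K) {{nonNegative (0≤fromℕ K)}} px≤x) px≤x ⟩
    fromℕ K * x + x             ≤⟨ +-monoˡ-≤ x (K*p^K≤geom K 0≤p p≤1) ⟩
    geom p K + x                ∎
    where
    open ≤-Reasoning
    x = p ^ℚ K
    px≤x = p≤1⇒p*q≤q (0≤p^K K 0≤p) p≤1

  module Trials (N′ F S : ℕ) (F+S≡N : F ℕ.+ S ≡ suc N′) where

    N : ℕ
    N = suc N′

    p : ℚ
    p = + F / N

    p*N≡F : p * fromℕ N ≡ fromℕ F
    p*N≡F = [a/n]*n≡a F N′

    [1-p]*N≡S : (1ℚ - p) * fromℕ N ≡ fromℕ S
    [1-p]*N≡S = begin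
      (1ℚ - p) * fromℕ N                ≡⟨ solve 2 (λ p n → (con 1ℚ :- p) :* n := n :- p :* n) refl p (fromℕ N) ⟩
      fromℕ N - p * fromℕ N             ≡⟨ cong₂ _-_ (trans (cong fromℕ (sym F+S≡N)) (fromℕ-+ F S)) p*N≡F ⟩
      (fromℕ F + fromℕ S) - fromℕ F     ≡⟨ solve 2 (λ f s → (f :+ s) :- f := s) refl (fromℕ F) (fromℕ S) ⟩
      fromℕ S                           ∎
      where open ≡-Reasoning

    0≤p : 0ℚ ≤ p
    0≤p = 0≤a/n F N′

    p≤1 : p ≤ 1ℚ
    p≤1 = *-cancelʳ-≤-fromℕ-suc N′ (begin
      p * fromℕ N      ≡⟨ p*N≡F ⟩
      fromℕ F          ≤⟨ fromℕ-mono-≤ (subst (F ℕ.≤_) F+S≡N (m≤m+n F S)) ⟩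
      fromℕ N          ≡⟨ *-identityˡ (fromℕ N) ⟨
      1ℚ * fromℕ N     ∎)
      where open ≤-Reasoning

    geom*S≡[1-p^K]*N : ∀ K → geom p K * fromℕ S ≡ (1ℚ - p ^ℚ K) * fromℕ N
    geom*S≡[1-p^K]*N K = begin
      geom p K * fromℕ S                  ≡⟨ cong (geom p K *_) [1-p]*N≡S ⟨
      geom p K * ((1ℚ - p) * fromℕ N)     ≡⟨ solve 3 (λ g r n → g :* (r :* n) := (r :* g) :* n) refl (geom p K) (1ℚ - p) (fromℕ N) ⟩
      ((1ℚ - p) * geom p K) * fromℕ N     ≡⟨ cong (_* fromℕ N) ([1-p]*geom≡1-p^K p K) ⟩
      (1ℚ - p ^ℚ K) * fromℕ N             ∎
      where open ≡-Reasoning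

    geom*S≤N : ∀ K → geom p K * fromℕ S ≤ fromℕ N
    geom*S≤N K = begin
      geom p K * fromℕ S          ≡⟨ geom*S≡[1-p^K]*N K ⟩
      (1ℚ - p ^ℚ K) * fromℕ N     ≤⟨ *-monoʳ-≤-nonNeg (fromℕ N) {{nonNegative (0≤fromℕ N)}} (1-p≤1 (0≤p^K K 0≤p)) ⟩
      1ℚ * fromℕ N                ≡⟨ *-identityˡ (fromℕ N) ⟩
      fromℕ N                     ∎
      where open ≤-Reasoning

    p^[N*D]*D≤1 : 1 ℕ.≤ S → ∀ D → p ^ℚ (N ℕ.* D) * fromℕ D ≤ 1ℚ
    p^[N*D]*D≤1 1≤S D = *-cancelʳ-≤-fromℕ-suc N′ (begin
      x * fromℕ D * fromℕ N          ≡⟨ solve 3 (λ x d n → x :* d :* n := (n :* d) :* x) refl x (fromℕ D) (fromℕ N) ⟩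
      fromℕ N * fromℕ D * x          ≡⟨ cong (_* x) (fromℕ-* N D) ⟨
      fromℕ K * x                    ≤⟨ 1≤q⇒p≤p*q (0≤p*q (0≤fromℕ K) (0≤p^K K 0≤p)) (fromℕ-mono-≤ 1≤S) ⟩
      fromℕ K * x * fromℕ S          ≤⟨ *-monoʳ-≤-nonNeg (fromℕ S) {{nonNegative (0≤fromℕ S)}} (K*p^K≤geom K 0≤p p≤1) ⟩
      geom p K * fromℕ S             ≤⟨ geom*S≤N K ⟩
      fromℕ N                        ≡⟨ *-identityˡ (fromℕ N) ⟨
      1ℚ * fromℕ N                   ∎)
      where
      open ≤-Reasoning
      K = N ℕ.* D
      x = p ^ℚ K

    geom*S→N : 1 ℕ.≤ S → ∀ ε → 0ℚ < ε → Σ[ K ∈ ℕ ] (1ℚ - ε) * fromℕ N ≤ geom p K * fromℕ S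
    geom*S→N 1≤S ε 0<ε with archimedean ε 0<ε
    ... | d , 1≤ε*D = K , (begin
      (1ℚ - ε) * fromℕ N             ≤⟨ *-monoʳ-≤-nonNeg (fromℕ N) {{nonNegative (0≤fromℕ N)}} (+-monoʳ-≤ 1ℚ (neg-antimono-≤ x≤ε)) ⟩
      (1ℚ - x) * fromℕ N             ≡⟨ geom*S≡[1-p^K]*N K ⟨
      geom p K * fromℕ S             ∎)
      where
      open ≤-Reasoning
      D = suc d
      K = N ℕ.* D
      x = p ^ℚ K
      x≤ε : x ≤ ε
      x≤ε = begin
        x                            ≤⟨ 1≤q⇒p≤p*q (0≤p^K K 0≤p) 1≤ε*D ⟩
        x * (ε * fromℕ D)            ≡⟨ solve 3 (λ x e d → x :* (e :* d) := e :* (x :* d)) refl x ε (fromℕ D) ⟩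
        ε * (x * fromℕ D)            ≤⟨ *-monoˡ-≤-nonNeg ε {{nonNegative (<⇒≤ 0<ε)}} (p^[N*D]*D≤1 1≤S D) ⟩
        ε * 1ℚ                       ≡⟨ *-identityʳ ε ⟩
        ε                            ∎

    geom*x≤c*N : ∀ K x c → x ℕ.≤ c ℕ.* S → geom p K * fromℕ x ≤ fromℕ c * fromℕ N
    geom*x≤c*N K x c x≤cS = begin
      geom p K * fromℕ x               ≤⟨ *-monoˡ-≤-nonNeg (geom p K) {{nonNegative (0≤geom K 0≤p)}} (fromℕ-mono-≤ x≤cS) ⟩
      geom p K * fromℕ (c ℕ.* S)       ≡⟨ cong (geom p K *_) (fromℕ-* c S) ⟩
      geom p K * (fromℕ c * fromℕ S)   ≡⟨ solve 3 (λ g c s → g :* (c :* s) := c :* (g :* s)) refl (geom p K) (fromℕ c) (fromℕ S) ⟩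
      fromℕ c * (geom p K * fromℕ S)   ≤⟨ *-monoˡ-≤-nonNeg (fromℕ c) {{nonNegative (0≤fromℕ c)}} (geom*S≤N K) ⟩
      fromℕ c * fromℕ N                ∎
      where open ≤-Reasoning

    hitWithin : ℕ → ℕ → ℚ
    hitWithin h K = sumTo K (λ k → p ^ℚ k * (+ h / N))

    hitWithin*m*N≡geom*hm : ∀ h K m → hitWithin h K * fromℕ m * fromℕ N ≡ geom p K * fromℕ (h ℕ.* m)
    hitWithin*m*N≡geom*hm h K m = begin
      hitWithin h K * fromℕ m * fromℕ N                ≡⟨ cong (λ s → s * fromℕ m * fromℕ N) (sumTo-*ʳ K (p ^ℚ_) q) ⟩
      geom p K * q * fromℕ m * fromℕ N                 ≡⟨ solve 4 (λ g q m n → g :* q :* m :* n := g :* ((q :* n) :* m)) refl (geom p K) q (fromℕ m) (fromℕ N) ⟩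
      geom p K * ((q * fromℕ N) * fromℕ m)             ≡⟨ cong (λ x → geom p K * (x * fromℕ m)) ([a/n]*n≡a h N′) ⟩
      geom p K * (fromℕ h * fromℕ m)                   ≡⟨ cong (geom p K *_) (fromℕ-* h m) ⟨
      geom p K * fromℕ (h ℕ.* m)                       ∎
      where
      open ≡-Reasoning
      q = + h / N

    hitWithin*m≤c : ∀ h m c → h ℕ.* m ℕ.≤ c ℕ.* S → ∀ K → hitWithin h K * fromℕ m ≤ fromℕ c
    hitWithin*m≤c h m c hm≤cS K = *-cancelʳ-≤-fromℕ-suc N′ (begin
      hitWithin h K * fromℕ m * fromℕ N   ≡⟨ hitWithin*m*N≡geom*hm h K m ⟩
      geom p K * fromℕ (h ℕ.* m)          ≤⟨ geom*x≤c*N K (h ℕ.* m) c hm≤cS ⟩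
      fromℕ c * fromℕ N                   ∎)
      where open ≤-Reasoning

    ½-ε≤hitWithin*m-at : ∀ h m → S ℕ.≤ 2 ℕ.* (h ℕ.* m) → ∀ ε → 0ℚ < ε → ∀ K →
      (1ℚ - ε) * fromℕ N ≤ geom p K * fromℕ S → ½ - ε ≤ hitWithin h K * fromℕ m
    ½-ε≤hitWithin*m-at h m S≤2hm ε 0<ε K [1-ε]N≤geom*S = *-cancelʳ-≤-fromℕ-suc N′ (begin
      (½ - ε) * fromℕ N
        ≤⟨ *-monoʳ-≤-nonNeg (fromℕ N) {{nonNegative (0≤fromℕ N)}} (+-monoʳ-≤ ½ (neg-antimono-≤ ½ε≤ε)) ⟩
      (½ - ½ * ε) * fromℕ N
        ≡⟨ solve 3 (λ h e n → (h :- h :* e) :* n := h :* ((con 1ℚ :- e) :* n)) refl ½ ε (fromℕ N) ⟩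
      ½ * ((1ℚ - ε) * fromℕ N)
        ≤⟨ *-monoˡ-≤-nonNeg ½ [1-ε]N≤geom*S ⟩
      ½ * (geom p K * fromℕ S)
        ≤⟨ *-monoˡ-≤-nonNeg ½ (*-monoˡ-≤-nonNeg (geom p K) {{nonNegative (0≤geom K 0≤p)}} (fromℕ-mono-≤ S≤2hm)) ⟩
      ½ * (geom p K * fromℕ (2 ℕ.* (h ℕ.* m)))
        ≡⟨ cong (λ x → ½ * (geom p K * x)) (fromℕ-* 2 (h ℕ.* m)) ⟩
      ½ * (geom p K * (fromℕ 2 * fromℕ (h ℕ.* m)))
        ≡⟨ solve 4 (λ o g t x → o :* (g :* (t :* x)) := (o :* t) :* (g :* x)) refl ½ (geom p K) (fromℕ 2) (fromℕ (h ℕ.* m)) ⟩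
      (½ * fromℕ 2) * (geom p K * fromℕ (h ℕ.* m))
        ≡⟨ cong (_* (geom p K * fromℕ (h ℕ.* m))) ½*2≡1 ⟩
      1ℚ * (geom p K * fromℕ (h ℕ.* m))
        ≡⟨ *-identityˡ (geom p K * fromℕ (h ℕ.* m)) ⟩
      geom p K * fromℕ (h ℕ.* m)
        ≡⟨ hitWithin*m*N≡geom*hm h K m ⟨
      hitWithin h K * fromℕ m * fromℕ N ∎)
      where
      open ≤-Reasoning
      ½*2≡1 : ½ * fromℕ 2 ≡ 1ℚ
      ½*2≡1 = refl
      ½ε≤ε : ½ * ε ≤ ε
      ½ε≤ε = p≤1⇒p*q≤q {½} (<⇒≤ 0<ε) (≤ᵇ⇒≤ _)

    ½-ε≤hitWithin*m : ∀ h m → 1 ℕ.≤ S → S ℕ.≤ 2 ℕ.* (h ℕ.* m) → ∀ ε → 0ℚ < ε →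
      Σ[ K ∈ ℕ ] ½ - ε ≤ hitWithin h K * fromℕ m
    ½-ε≤hitWithin*m h m 1≤S S≤2hm ε 0<ε =
      map₂ (λ {K} → ½-ε≤hitWithin*m-at h m S≤2hm ε 0<ε K) (geom*S→N 1≤S ε 0<ε)

    geom*M/n≤c*t : ∀ K M n t c → N ≡ suc n ℕ.* t → M ℕ.≤ c ℕ.* S →
      geom p K * (+ M / suc n) ≤ fromℕ c * fromℕ t
    geom*M/n≤c*t K M n t c N≡nt M≤cS = *-cancelʳ-≤-fromℕ-suc n (begin
      geom p K * (+ M / suc n) * fromℕ (suc n)   ≡⟨ *-assoc (geom p K) (+ M / suc n) (fromℕ (suc n)) ⟩
      geom p K * ((+ M / suc n) * fromℕ (suc n)) ≡⟨ cong (geom p K *_) ([a/n]*n≡a M n) ⟩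
      geom p K * fromℕ M                         ≤⟨ geom*x≤c*N K M c M≤cS ⟩
      fromℕ c * fromℕ N                          ≡⟨ cong (fromℕ c *_) (trans (cong fromℕ N≡nt) (fromℕ-* (suc n) t)) ⟩
      fromℕ c * (fromℕ (suc n) * fromℕ t)        ≡⟨ solve 3 (λ c n t → c :* (n :* t) := c :* t :* n) refl (fromℕ c) (fromℕ (suc n)) (fromℕ t) ⟩
      fromℕ c * fromℕ t * fromℕ (suc n)          ∎)
      where open ≤-Reasoning

open IndicatorSums using (sum-#≡∑∑)
open LightEdges
open Rounds
open NatCast
open Geometric
open import Data.Nat as ℕ using (ℕ; zero; suc)
import Data.Nat.Properties as ℕ
open import Data.Fin using (Fin; toℕ)
open import Data.Bool using (true)
open import Data.Maybe using (just)
open import Data.Product using (Σ; Σ-syntax; _×_; _,_; map₂)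
open import Data.Integer using (+_)
open import Data.Rational using (ℚ; _≤_; _<_; _*_; _-_; 0ℚ; _/_; ½)
open import Data.Rational.Properties using (positive⁻¹; *-zeroʳ; ≤-reflexive; ≤-trans)
open import Relation.Binary.PropositionalEquality

module SampledGraph (n′ t′ : ℕ) (G : Graph (suc n′)) where
  t : ℕ
  t = suc t′
  open Procedure G t hiding (N)
  open Trials (t′ ℕ.+ n′ ℕ.* t) (failures G t) (lightDegreeSum G t) (failures+lightDegreeSum≡nt G t)

  pFail≡p : pFail ≡ p
  pFail≡p = cong (λ z → + z / N) (sum-#≡∑∑ {suc n′} {t} failB)

  probOutputWithin≡hitWithin : ∀ a b K → probOutputWithin a b K ≡ hitWithin (hits G t a b) K
  probOutputWithin≡hitWithin a b K = cong₂ (λ x y → sumTo K (λ k → x ^ℚ k * y))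
    pFail≡p (cong (λ z → + z / N) (sum-#≡∑∑ {suc n′} {t} (hitsB a b)))

  output-probability-bounds : ∀ a b → hEdgeB G t a b ≡ true →
    (∀ K → probOutputWithin a b K * fromℕ (numHEdges G t) ≤ fromℕ 2)
    × (∀ ε → 0ℚ < ε → Σ[ K ∈ ℕ ] ½ - ε ≤ probOutputWithin a b K * fromℕ (numHEdges G t))
  output-probability-bounds a b e =
    (λ K → subst (λ x → x * fromℕ m′ ≤ fromℕ 2) (sym (probOutputWithin≡hitWithin a b K)) (hitWithin*m≤c h m′ 2 hm′≤2S K)) ,
    (λ ε 0<ε → map₂ (λ {K} → subst (λ x → ½ - ε ≤ x * fromℕ m′) (sym (probOutputWithin≡hitWithin a b K)))
                    (½-ε≤hitWithin*m h m′ 1≤S S≤2hm′ ε 0<ε))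
    where
    h m′ S : ℕ
    h = hits G t a b
    m′ = numHEdges G t
    S = lightDegreeSum G t
    1≤h : 1 ℕ.≤ h
    1≤h = 1≤hits G t a b e
    1≤S : 1 ℕ.≤ S
    1≤S = ℕ.≤-trans 1≤h (hits≤lightDegreeSum G t a b)
    hm′≤2S : h ℕ.* m′ ℕ.≤ 2 ℕ.* S
    hm′≤2S = ℕ.*-mono-≤ (hits≤2 G t a b) (numHEdges≤lightDegreeSum G t)
    S≤2hm′ : S ℕ.≤ 2 ℕ.* (h ℕ.* m′)
    S≤2hm′ = ℕ.≤-trans (lightDegreeSum≤2*numHEdges G t) (ℕ.*-monoʳ-≤ 2 (ℕ.m≤n*m m′ h {{ℕ.>-nonZero 1≤h}}))

  expected-rounds-bound : numEdges G ℕ.≤ 2 ℕ.* numHEdges G t →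
    ∀ K → expRoundsUpTo K * avgDeg G ≤ fromℕ 4 * fromℕ t
  expected-rounds-bound m≤2m′ K =
    subst (λ x → geom x K * avgDeg G ≤ fromℕ 4 * fromℕ t) (sym pFail≡p)
          (geom*M/n≤c*t K (2 ℕ.* numEdges G) n′ t 4 refl 2m≤4S)
    where
    2m≤4S : 2 ℕ.* numEdges G ℕ.≤ 4 ℕ.* lightDegreeSum G t
    2m≤4S = ℕ.≤-trans (ℕ.*-monoʳ-≤ 2 (ℕ.≤-trans m≤2m′ (ℕ.*-monoʳ-≤ 2 (numHEdges≤lightDegreeSum G t))))
                      (ℕ.≤-reflexive (sym (ℕ.*-assoc 2 2 (lightDegreeSum G t))))

output-probability-bounds : ∀ n (G : Graph n) t → 0 ℕ.< t → ∀ a b → hEdgeB G t a b ≡ true →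
  let open Procedure G t in
  (∀ K → probOutputWithin a b K * fromℕ (numHEdges G t) ≤ fromℕ 2)
  × (∀ ε → 0ℚ < ε → Σ[ K ∈ ℕ ] ½ - ε ≤ probOutputWithin a b K * fromℕ (numHEdges G t))
output-probability-bounds (suc n) G (suc t) _ = SampledGraph.output-probability-bounds n t G

expected-rounds-bound : ∀ n (G : Graph n) t → 0 ℕ.< t → numEdges G ℕ.≤ 2 ℕ.* numHEdges G t →
  ∀ K → Procedure.expRoundsUpTo G t K * avgDeg G ≤ fromℕ 4 * fromℕ t
expected-rounds-bound zero    G t       _ _ K = ≤-trans (≤-reflexive (*-zeroʳ (Procedure.expRoundsUpTo G t K))) (0≤p*q (0≤fromℕ 4) (0≤fromℕ t))
expected-rounds-bound (suc n) G (suc t) _     = SampledGraph.expected-rounds-bound n t G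

claim6 : Σ ℚ λ c₁ → Σ ℚ λ c₂ → Σ ℚ λ C →
    (0ℚ < c₁) × (0ℚ < c₂) ×
    (∀ (n : ℕ) (G : Graph n) (t : ℕ) → 0 ℕ.< t →
      let open Procedure G t in
      (∀ (v : Fin n) (j : Fin t) (u : Fin n) → round v j ≡ just u →
          hEdgeB G t v u ≡ true)
      × (∀ (a b : Fin n) → toℕ a ℕ.< toℕ b → hEdgeB G t a b ≡ true →
          ((∀ (K : ℕ) → probOutputWithin a b K * (+ numHEdges G t / 1) ≤ c₂)
          × (∀ (ε : ℚ) → 0ℚ < ε → Σ ℕ λ K →
               c₁ - ε ≤ probOutputWithin a b K * (+ numHEdges G t / 1))))
      × (numEdges G ℕ.≤ 2 ℕ.* numHEdges G t →
          ∀ (K : ℕ) → expRoundsUpTo K * avgDeg G ≤ C * (+ t / 1)))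
claim6 = ½ , fromℕ 2 , fromℕ 4 , positive⁻¹ ½ , positive⁻¹ (fromℕ 2) , λ n G t 0<t →
  round-sound G t ,
  -- the order a < b only selects one representative of the unordered pair
  (λ a b _ → output-probability-bounds n G t 0<t a b) ,
  expected-rounds-bound n G t 0<t
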